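{- Let $\lambda X$ be a supersorted pure type system. Then for every context $\Gamma$, variable $x$ and pseudoterms $A,M,B$: if $\Gamma,x:A\vdash M:B$ is derivable in $\lambda X$, then $\Gamma\vdash(\lambda x{:}A.M):(\Pi x{:}A.B)$ is derivable in $\lambda X$. Consequently, in $\lambda X$ the (abstraction) rule can be replaced by the rule "from $\Gamma,x:A\vdash M:B$ infer $\Gamma\vdash(\lambda x{:}A.M):(\Pi x{:}A.B)$" without changing the set of derivable judgements.
   Context: Pure type systems (PTS): a PTS has variables, constants $\mathcal C$, sorts $\mathcal S\subseteq\mathcal C$, axioms $\mathcal A$ ($c:s$), rules $\mathcal R\subseteq\mathcal S^3$; pseudoterms $\mathcal T::=V\mid\mathcal C\mid\Pi V{:}\mathcal T.\mathcal T\mid\lambda V{:}\mathcal T.\mathcal T\mid\mathcal T\mathcal T$; derivable judgements $\Gamma\vdash M:A$ ($\Gamma$ a finite sequence of declarations $x:A$) are generated by (axiom) $\vdash c:s$ for $(c:s)\in\mathcal A$; (start) $\Gamma\vdash A:s\Rightarrow\Gamma,x:A\vdash x:A$ ($x$ fresh); (weakening) $\Gamma\vdash M:B$, $\Gamma\vdash A:s\Rightarrow\Gamma,x:A\vdash M:B$ ($x$ fresh); (application) $\Gamma\vdash M:\Pi x{:}A.B$, $\Gamma\vdash N:A\Rightarrow\Gamma\vdash MN:B[x:=N]$; (abstraction) $\Gamma,x:A\vdash M:B$, $\Gamma\vdash(\Pi x{:}A.B):s\Rightarrow\Gamma\vdash(\lambda x{:}A.M):(\Pi x{:}A.B)$;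 (product) $\Gamma,x:A\vdash B:s_2$, $\Gamma\vdash A:s_1$, $(s_1,s_2,s_3)\in\mathcal R\Rightarrow\Gamma\vdash(\Pi x{:}A.B):s_3$; (conversion) $\Gamma\vdash M:A$, $\Gamma\vdash B:s$, $A=_\beta B\Rightarrow\Gamma\vdash M:B$ (with $s,s_i\in\mathcal S$). A PTS is supersorted if for every $c\in\mathcal C$ there is $s\in\mathcal S$ with $(c:s)\in\mathcal A$, and for all $s_1,s_2\in\mathcal S$ there is $s_3\in\mathcal S$ with $(s_1,s_2,s_3)\in\mathcal R$. -}

module Defs where

open import Data.Nat using (ℕ; zero; suc)
open import Data.Product using (Σ; _×_; _,_)
open import Relation.Binary.Construct.Closure.Equivalence using (EqClosure)

record PTS : Set₁ where
  field
    Const       : Set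
    IsSort      : Const → Set
    Axiom       : Const → Const → Set            -- Axiom c s  means  (c : s) ∈ 𝒜
    Rule        : Const → Const → Const → Set
    axiom-sort  : ∀ {c s} → Axiom c s → IsSort s
    rule-sort₁  : ∀ {s₁ s₂ s₃} → Rule s₁ s₂ s₃ → IsSort s₁
    rule-sort₂  : ∀ {s₁ s₂ s₃} → Rule s₁ s₂ s₃ → IsSort s₂
    rule-sort₃  : ∀ {s₁ s₂ s₃} → Rule s₁ s₂ s₃ → IsSort s₃

record Supersorted (P : PTS) : Set where
  open PTS P
  field
    const-typed : ∀ c → Σ Const λ s → IsSort s × Axiom c s
    rule-total  : ∀ s₁ s₂ → IsSort s₁ → IsSort s₂ →
                  Σ Const λ s₃ → IsSort s₃ × Rule s₁ s₂ s₃

module _ (P : PTS) where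
  open PTS P

  -- Pseudoterms, with variables as de Bruijn indices (binders are Π and λ).
  data Term : Set where
    var   : ℕ → Term
    const : Const → Term
    pi    : Term → Term → Term      -- pi A B  =  Π x:A. B   (x bound in B)
    lam   : Term → Term → Term      -- lam A M =  λ x:A. M   (x bound in M)
    app   : Term → Term → Term

  ext : (ℕ → ℕ) → ℕ → ℕ
  ext ρ zero    = zero
  ext ρ (suc n) = suc (ρ n)

  rename : (ℕ → ℕ) → Term → Term
  rename ρ (var n)   = var (ρ n)
  rename ρ (const c) = const c
  rename ρ (pi A B)  = pi (rename ρ A) (rename (ext ρ) B)
  rename ρ (lam A M) = lam (rename ρ A) (rename (ext ρ) M)
  rename ρ (app M N) = app (rename ρ M) (rename ρ N)

  shift : Term → Term
  shift = rename suc

  exts : (ℕ → Term) → ℕ → Term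
  exts σ zero    = var zero
  exts σ (suc n) = shift (σ n)

  subst : (ℕ → Term) → Term → Term
  subst σ (var n)   = σ n
  subst σ (const c) = const c
  subst σ (pi A B)  = pi (subst σ A) (subst (exts σ) B)
  subst σ (lam A M) = lam (subst σ A) (subst (exts σ) M)
  subst σ (app M N) = app (subst σ M) (subst σ N)

  single : Term → ℕ → Term
  single N zero    = N
  single N (suc n) = var n

  -- B [ N ]  =  B[x := N] where x is the outermost bound variable (index 0)
  _[_] : Term → Term → Term
  B [ N ] = subst (single N) B

  data _⟶β_ : Term → Term → Set where
    β      : ∀ {A M N} → app (lam A M) N ⟶β (M [ N ])
    pi₁    : ∀ {A A′ B} → A ⟶β A′ → pi A B ⟶β pi A′ B
    pi₂    : ∀ {A B B′} → B ⟶β B′ → pi A B ⟶β pi A B′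
    lam₁   : ∀ {A A′ M} → A ⟶β A′ → lam A M ⟶β lam A′ M
    lam₂   : ∀ {A M M′} → M ⟶β M′ → lam A M ⟶β lam A M′
    app₁   : ∀ {M M′ N} → M ⟶β M′ → app M N ⟶β app M′ N
    app₂   : ∀ {M N N′} → N ⟶β N′ → app M N ⟶β app M N′

  _=β_ : Term → Term → Set
  _=β_ = EqClosure _⟶β_

  -- Contexts: finite sequences of declarations; in de Bruijn form the
  -- declaration x:A is just A (the last one is variable 0).
  data Ctx : Set where
    ε   : Ctx
    _▸_ : Ctx → Term → Ctx

  infixl 5 _▸_
  infix 4 _⊢_∶_ _⊢′_∶_

  data _⊢_∶_ : Ctx → Term → Term → Set where
    axiom : ∀ {c s} → Axiom c s → ε ⊢ const c ∶ const s
    start : ∀ {Γ A s} → IsSort s → Γ ⊢ A ∶ const s →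
            (Γ ▸ A) ⊢ var zero ∶ shift A
    weak  : ∀ {Γ M B A s} → Γ ⊢ M ∶ B → IsSort s → Γ ⊢ A ∶ const s →
            (Γ ▸ A) ⊢ shift M ∶ shift B
    appl  : ∀ {Γ M N A B} → Γ ⊢ M ∶ pi A B → Γ ⊢ N ∶ A →
            Γ ⊢ app M N ∶ (B [ N ])
    abst  : ∀ {Γ A M B s} → (Γ ▸ A) ⊢ M ∶ B → IsSort s → Γ ⊢ pi A B ∶ const s →
            Γ ⊢ lam A M ∶ pi A B
    prod  : ∀ {Γ A B s₁ s₂ s₃} → (Γ ▸ A) ⊢ B ∶ const s₂ → Γ ⊢ A ∶ const s₁ →
            Rule s₁ s₂ s₃ → Γ ⊢ pi A B ∶ const s₃
    conv  : ∀ {Γ M A B s} → Γ ⊢ M ∶ A → IsSort s → Γ ⊢ B ∶ const s → A =β B →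
            Γ ⊢ M ∶ B

  data _⊢′_∶_ : Ctx → Term → Term → Set where
    axiom : ∀ {c s} → Axiom c s → ε ⊢′ const c ∶ const s
    start : ∀ {Γ A s} → IsSort s → Γ ⊢′ A ∶ const s →
            (Γ ▸ A) ⊢′ var zero ∶ shift A
    weak  : ∀ {Γ M B A s} → Γ ⊢′ M ∶ B → IsSort s → Γ ⊢′ A ∶ const s →
            (Γ ▸ A) ⊢′ shift M ∶ shift B
    appl  : ∀ {Γ M N A B} → Γ ⊢′ M ∶ pi A B → Γ ⊢′ N ∶ A →
            Γ ⊢′ app M N ∶ (B [ N ])
    abst′ : ∀ {Γ A M B} → (Γ ▸ A) ⊢′ M ∶ B →
            Γ ⊢′ lam A M ∶ pi A B
    prod  : ∀ {Γ A B s₁ s₂ s₃} → (Γ ▸ A) ⊢′ B ∶ const s₂ → Γ ⊢′ A ∶ const s₁ →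
            Rule s₁ s₂ s₃ → Γ ⊢′ pi A B ∶ const s₃
    conv  : ∀ {Γ M A B s} → Γ ⊢′ M ∶ A → IsSort s → Γ ⊢′ B ∶ const s → A =β B →
            Γ ⊢′ M ∶ B

-- A derivation of Γ, x:A ⊢ M : B already contains Γ ⊢ A : s₁ (the context is legal), and
-- correctness of types gives Γ, x:A ⊢ B : s₂; the latter needs only that no sort is a top
-- sort, and is proved from thinning, the substitution lemma and generation for Π.
-- Supersortedness then supplies a rule (s₁, s₂, s₃), so the product rule derives the side
-- premise Γ ⊢ Πx:A.B : s₃ of (abstraction).
module Submission where

open import Data.Nat using (ℕ; zero; suc)
open import Data.Product using (Σ; _×_; _,_)
open import Function using (_∘_)
open import Relation.Binary.PropositionalEquality
  using (_≡_; _≗_; refl; sym; trans; cong; cong₂; module ≡-Reasoning)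
import Relation.Binary.PropositionalEquality as Eq
import Relation.Binary.Construct.Closure.Equivalence as EqClosure

open import Defs
  hiding (ext; rename; shift; exts; subst; single; _[_]; _⟶β_; _=β_; _⊢_∶_; _⊢′_∶_)

module Metatheory (P : PTS) where
  open PTS P
  open ≡-Reasoning

  ext : (ℕ → ℕ) → ℕ → ℕ
  ext = Defs.ext P

  rename : (ℕ → ℕ) → Term P → Term P
  rename = Defs.rename P

  shift : Term P → Term P
  shift = Defs.shift P

  exts : (ℕ → Term P) → ℕ → Term P
  exts = Defs.exts P

  subst : (ℕ → Term P) → Term P → Term P
  subst = Defs.subst P

  single : Term P → ℕ → Term P
  single = Defs.single P

  _[_] : Term P → Term P → Term P
  _[_] = Defs._[_] P

  _⟶β_ : Term P → Term P → Set
  _⟶β_ = Defs._⟶β_ P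

  _=β_ : Term P → Term P → Set
  _=β_ = Defs._=β_ P

  infix 4 _⊢_∶_ _⊢′_∶_ _⊢_type

  _⊢_∶_ : Ctx P → Term P → Term P → Set
  _⊢_∶_ = Defs._⊢_∶_ P

  _⊢′_∶_ : Ctx P → Term P → Term P → Set
  _⊢′_∶_ = Defs._⊢′_∶_ P

  private variable
    ρ ρ′ : ℕ → ℕ
    σ τ : ℕ → Term P
    Γ Δ : Ctx P
    A B C M N : Term P

  ext-cong : ρ ≗ ρ′ → ext ρ ≗ ext ρ′
  ext-cong h zero    = refl
  ext-cong h (suc n) = cong suc (h n)

  rename-cong : ρ ≗ ρ′ → rename ρ ≗ rename ρ′
  rename-cong h (var n)   = cong var (h n)
  rename-cong h (const c) = refl
  rename-cong h (pi A B)  = cong₂ pi (rename-cong h A) (rename-cong (ext-cong h) B)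
  rename-cong h (lam A M) = cong₂ lam (rename-cong h A) (rename-cong (ext-cong h) M)
  rename-cong h (app M N) = cong₂ app (rename-cong h M) (rename-cong h N)

  exts-cong : σ ≗ τ → exts σ ≗ exts τ
  exts-cong h zero    = refl
  exts-cong h (suc n) = cong shift (h n)

  subst-cong : σ ≗ τ → subst σ ≗ subst τ
  subst-cong h (var n)   = h n
  subst-cong h (const c) = refl
  subst-cong h (pi A B)  = cong₂ pi (subst-cong h A) (subst-cong (exts-cong h) B)
  subst-cong h (lam A M) = cong₂ lam (subst-cong h A) (subst-cong (exts-cong h) M)
  subst-cong h (app M N) = cong₂ app (subst-cong h M) (subst-cong h N)

  ext-∘ : ∀ ρ ρ′ → ext (ρ ∘ ρ′) ≗ ext ρ ∘ ext ρ′
  ext-∘ ρ ρ′ zero    = refl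
  ext-∘ ρ ρ′ (suc n) = refl

  rename-∘ : ∀ ρ ρ′ M → rename ρ (rename ρ′ M) ≡ rename (ρ ∘ ρ′) M
  rename-∘ ρ ρ′ (var n)   = refl
  rename-∘ ρ ρ′ (const c) = refl
  rename-∘ ρ ρ′ (pi A B)  = cong₂ pi (rename-∘ ρ ρ′ A)
    (trans (rename-∘ (ext ρ) (ext ρ′) B) (sym (rename-cong (ext-∘ ρ ρ′) B)))
  rename-∘ ρ ρ′ (lam A M) = cong₂ lam (rename-∘ ρ ρ′ A)
    (trans (rename-∘ (ext ρ) (ext ρ′) M) (sym (rename-cong (ext-∘ ρ ρ′) M)))
  rename-∘ ρ ρ′ (app M N) = cong₂ app (rename-∘ ρ ρ′ M) (rename-∘ ρ ρ′ N)

  exts-ext : ∀ σ ρ → exts σ ∘ ext ρ ≗ exts (σ ∘ ρ)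
  exts-ext σ ρ zero    = refl
  exts-ext σ ρ (suc n) = refl

  subst-rename : ∀ σ ρ M → subst σ (rename ρ M) ≡ subst (σ ∘ ρ) M
  subst-rename σ ρ (var n)   = refl
  subst-rename σ ρ (const c) = refl
  subst-rename σ ρ (pi A B)  = cong₂ pi (subst-rename σ ρ A)
    (trans (subst-rename (exts σ) (ext ρ) B) (subst-cong (exts-ext σ ρ) B))
  subst-rename σ ρ (lam A M) = cong₂ lam (subst-rename σ ρ A)
    (trans (subst-rename (exts σ) (ext ρ) M) (subst-cong (exts-ext σ ρ) M))
  subst-rename σ ρ (app M N) = cong₂ app (subst-rename σ ρ M) (subst-rename σ ρ N)

  rename-shift : ∀ ρ M → rename (ext ρ) (shift M) ≡ shift (rename ρ M)
  rename-shift ρ M = trans (rename-∘ (ext ρ) suc M) (sym (rename-∘ suc ρ M))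

  rename-exts : ∀ ρ σ → rename (ext ρ) ∘ exts σ ≗ exts (rename ρ ∘ σ)
  rename-exts ρ σ zero    = refl
  rename-exts ρ σ (suc n) = rename-shift ρ (σ n)

  rename-subst : ∀ ρ σ M → rename ρ (subst σ M) ≡ subst (rename ρ ∘ σ) M
  rename-subst ρ σ (var n)   = refl
  rename-subst ρ σ (const c) = refl
  rename-subst ρ σ (pi A B)  = cong₂ pi (rename-subst ρ σ A)
    (trans (rename-subst (ext ρ) (exts σ) B) (subst-cong (rename-exts ρ σ) B))
  rename-subst ρ σ (lam A M) = cong₂ lam (rename-subst ρ σ A)
    (trans (rename-subst (ext ρ) (exts σ) M) (subst-cong (rename-exts ρ σ) M))
  rename-subst ρ σ (app M N) = cong₂ app (rename-subst ρ σ M) (rename-subst ρ σ N)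

  subst-shift : ∀ σ M → subst (exts σ) (shift M) ≡ shift (subst σ M)
  subst-shift σ M = trans (subst-rename (exts σ) suc M) (sym (rename-subst suc σ M))

  subst-exts : ∀ σ τ → subst (exts σ) ∘ exts τ ≗ exts (subst σ ∘ τ)
  subst-exts σ τ zero    = refl
  subst-exts σ τ (suc n) = subst-shift σ (τ n)

  subst-subst : ∀ σ τ M → subst σ (subst τ M) ≡ subst (subst σ ∘ τ) M
  subst-subst σ τ (var n)   = refl
  subst-subst σ τ (const c) = refl
  subst-subst σ τ (pi A B)  = cong₂ pi (subst-subst σ τ A)
    (trans (subst-subst (exts σ) (exts τ) B) (subst-cong (subst-exts σ τ) B))
  subst-subst σ τ (lam A M) = cong₂ lam (subst-subst σ τ A)
    (trans (subst-subst (exts σ) (exts τ) M) (subst-cong (subst-exts σ τ) M))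
  subst-subst σ τ (app M N) = cong₂ app (subst-subst σ τ M) (subst-subst σ τ N)

  exts-var : exts var ≗ var
  exts-var zero    = refl
  exts-var (suc n) = refl

  subst-var : ∀ M → subst var M ≡ M
  subst-var (var n)   = refl
  subst-var (const c) = refl
  subst-var (pi A B)  = cong₂ pi (subst-var A) (trans (subst-cong exts-var B) (subst-var B))
  subst-var (lam A M) = cong₂ lam (subst-var A) (trans (subst-cong exts-var M) (subst-var M))
  subst-var (app M N) = cong₂ app (subst-var M) (subst-var N)

  shift-[] : ∀ M N → shift M [ N ] ≡ M
  shift-[] M N = trans (subst-rename (single N) suc M) (subst-var M)

  rename-single : ∀ ρ N → rename ρ ∘ single N ≗ single (rename ρ N) ∘ ext ρ
  rename-single ρ N zero    = refl
  rename-single ρ N (suc n) = refl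

  rename-[] : ∀ ρ M N → rename ρ (M [ N ]) ≡ rename (ext ρ) M [ rename ρ N ]
  rename-[] ρ M N = begin
    rename ρ (subst (single N) M)                 ≡⟨ rename-subst ρ (single N) M ⟩
    subst (rename ρ ∘ single N) M                 ≡⟨ subst-cong (rename-single ρ N) M ⟩
    subst (single (rename ρ N) ∘ ext ρ) M         ≡⟨ subst-rename (single (rename ρ N)) (ext ρ) M ⟨
    subst (single (rename ρ N)) (rename (ext ρ) M) ∎

  subst-single : ∀ σ N → subst σ ∘ single N ≗ subst (single (subst σ N)) ∘ exts σ
  subst-single σ N zero    = refl
  subst-single σ N (suc n) = sym (shift-[] (σ n) (subst σ N))

  subst-[] : ∀ σ M N → subst σ (M [ N ]) ≡ subst (exts σ) M [ subst σ N ]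
  subst-[] σ M N = begin
    subst σ (subst (single N) M)                        ≡⟨ subst-subst σ (single N) M ⟩
    subst (subst σ ∘ single N) M                        ≡⟨ subst-cong (subst-single σ N) M ⟩
    subst (subst (single (subst σ N)) ∘ exts σ) M       ≡⟨ subst-subst (single (subst σ N)) (exts σ) M ⟨
    subst (single (subst σ N)) (subst (exts σ) M)       ∎

  rename-⟶β : ∀ ρ → M ⟶β N → rename ρ M ⟶β rename ρ N
  rename-⟶β ρ (β {A} {M} {N}) = Eq.subst (rename ρ (app (lam A M) N) ⟶β_) (sym (rename-[] ρ M N)) β
  rename-⟶β ρ (pi₁ r)  = pi₁ (rename-⟶β ρ r)
  rename-⟶β ρ (pi₂ r)  = pi₂ (rename-⟶β (ext ρ) r)
  rename-⟶β ρ (lam₁ r) = lam₁ (rename-⟶β ρ r)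
  rename-⟶β ρ (lam₂ r) = lam₂ (rename-⟶β (ext ρ) r)
  rename-⟶β ρ (app₁ r) = app₁ (rename-⟶β ρ r)
  rename-⟶β ρ (app₂ r) = app₂ (rename-⟶β ρ r)

  subst-⟶β : ∀ σ → M ⟶β N → subst σ M ⟶β subst σ N
  subst-⟶β σ (β {A} {M} {N}) = Eq.subst (subst σ (app (lam A M) N) ⟶β_) (sym (subst-[] σ M N)) β
  subst-⟶β σ (pi₁ r)  = pi₁ (subst-⟶β σ r)
  subst-⟶β σ (pi₂ r)  = pi₂ (subst-⟶β (exts σ) r)
  subst-⟶β σ (lam₁ r) = lam₁ (subst-⟶β σ r)
  subst-⟶β σ (lam₂ r) = lam₂ (subst-⟶β (exts σ) r)
  subst-⟶β σ (app₁ r) = app₁ (subst-⟶β σ r)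
  subst-⟶β σ (app₂ r) = app₂ (subst-⟶β σ r)

  rename-=β : ∀ ρ → M =β N → rename ρ M =β rename ρ N
  rename-=β ρ = EqClosure.gmap (rename ρ) (rename-⟶β ρ)

  subst-=β : ∀ σ → M =β N → subst σ M =β subst σ N
  subst-=β σ = EqClosure.gmap (subst σ) (subst-⟶β σ)

  _++_ : Ctx P → Ctx P → Ctx P
  Γ ++ ε       = Γ
  Γ ++ (Δ ▸ A) = (Γ ++ Δ) ▸ A

  ext⋆ : Ctx P → (ℕ → ℕ) → ℕ → ℕ
  ext⋆ ε       ρ = ρ
  ext⋆ (Δ ▸ A) ρ = ext (ext⋆ Δ ρ)

  exts⋆ : Ctx P → (ℕ → Term P) → ℕ → Term P
  exts⋆ ε       σ = σ
  exts⋆ (Δ ▸ A) σ = exts (exts⋆ Δ σ)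

  renameCtx : (ℕ → ℕ) → Ctx P → Ctx P
  renameCtx ρ ε       = ε
  renameCtx ρ (Δ ▸ A) = renameCtx ρ Δ ▸ rename (ext⋆ Δ ρ) A

  substCtx : (ℕ → Term P) → Ctx P → Ctx P
  substCtx σ ε       = ε
  substCtx σ (Δ ▸ A) = substCtx σ Δ ▸ subst (exts⋆ Δ σ) A

  cast : M ≡ N → A ≡ B → Γ ⊢ M ∶ A → Γ ⊢ N ∶ B
  cast refl refl ⊢M = ⊢M

  _⊢_type : Ctx P → Term P → Set
  Γ ⊢ A type = Σ Const λ s → IsSort s × Γ ⊢ A ∶ const s

  context-head-type : Γ ▸ A ⊢ M ∶ B → Γ ⊢ A type
  context-head-type (start i ⊢A)    = _ , i , ⊢A
  context-head-type (weak _ i ⊢A)   = _ , i , ⊢A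
  context-head-type (appl ⊢M _)     = context-head-type ⊢M
  context-head-type (abst _ _ ⊢Π)   = context-head-type ⊢Π
  context-head-type (prod _ ⊢A _)   = context-head-type ⊢A
  context-head-type (conv ⊢M _ _ _) = context-head-type ⊢M

  axiom-in-context : ∀ Γ {c s} → Γ ⊢ M ∶ B → Axiom c s → Γ ⊢ const c ∶ const s
  axiom-in-context ε       _  ax = axiom ax
  axiom-in-context (Γ ▸ A) ⊢M ax =
    let _ , i , ⊢A = context-head-type ⊢M in weak (axiom-in-context Γ ⊢A ax) i ⊢A

  thinning : ∀ Γ Δ {C} → Γ ++ Δ ⊢ M ∶ B → Γ ⊢ C type →
             (Γ ▸ C) ++ renameCtx suc Δ ⊢ rename (ext⋆ Δ suc) M ∶ rename (ext⋆ Δ suc) B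
  thinning Γ Δ {C} ⊢M (_ , i , ⊢C) = go Δ ⊢M refl
    where
    -- Γ ++ Δ is not a pattern, so the context is abstracted and fixed by an equation.
    go : ∀ Δ {Θ M B} → Θ ⊢ M ∶ B → Θ ≡ Γ ++ Δ →
         (Γ ▸ C) ++ renameCtx suc Δ ⊢ rename (ext⋆ Δ suc) M ∶ rename (ext⋆ Δ suc) B
    go ε       ⊢M refl = weak ⊢M i ⊢C
    go (Δ ▸ _) (axiom _) ()
    go (Δ ▸ A) (start i′ ⊢A) refl =
      cast refl (sym (rename-shift (ext⋆ Δ suc) A)) (start i′ (go Δ ⊢A refl))
    go (Δ ▸ A) (weak {M = M} {B = B} ⊢M i′ ⊢A) refl =
      cast (sym (rename-shift (ext⋆ Δ suc) M)) (sym (rename-shift (ext⋆ Δ suc) B))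
        (weak (go Δ ⊢M refl) i′ (go Δ ⊢A refl))
    go Δ (appl {N = N} {B = B} ⊢M ⊢N) refl =
      cast refl (sym (rename-[] (ext⋆ Δ suc) B N)) (appl (go Δ ⊢M refl) (go Δ ⊢N refl))
    go Δ (abst {A = A} ⊢M i′ ⊢Π) refl = abst (go (Δ ▸ A) ⊢M refl) i′ (go Δ ⊢Π refl)
    go Δ (prod {A = A} ⊢B ⊢A r) refl = prod (go (Δ ▸ A) ⊢B refl) (go Δ ⊢A refl) r
    go Δ (conv ⊢M i′ ⊢B A=B) refl =
      conv (go Δ ⊢M refl) i′ (go Δ ⊢B refl) (rename-=β (ext⋆ Δ suc) A=B)

  substitution : ∀ Γ Δ {A N} → (Γ ▸ A) ++ Δ ⊢ M ∶ B → Γ ⊢ N ∶ A →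
                 Γ ++ substCtx (single N) Δ ⊢ subst (exts⋆ Δ (single N)) M ∶ subst (exts⋆ Δ (single N)) B
  substitution Γ Δ {A} {N} ⊢M ⊢N = go Δ ⊢M refl
    where
    go : ∀ Δ {Θ M B} → Θ ⊢ M ∶ B → Θ ≡ (Γ ▸ A) ++ Δ →
         Γ ++ substCtx (single N) Δ ⊢ subst (exts⋆ Δ (single N)) M ∶ subst (exts⋆ Δ (single N)) B
    go ε       (axiom _) ()
    go (Δ ▸ _) (axiom _) ()
    go ε (start _ _) refl = cast refl (sym (shift-[] A N)) ⊢N
    go ε (weak {M = M} {B = B} ⊢M _ _) refl = cast (sym (shift-[] M N)) (sym (shift-[] B N)) ⊢M
    go (Δ ▸ C) (start i ⊢C) refl =
      cast refl (sym (subst-shift (exts⋆ Δ (single N)) C)) (start i (go Δ ⊢C refl))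
    go (Δ ▸ C) (weak {M = M} {B = B} ⊢M i ⊢C) refl =
      cast (sym (subst-shift (exts⋆ Δ (single N)) M)) (sym (subst-shift (exts⋆ Δ (single N)) B))
        (weak (go Δ ⊢M refl) i (go Δ ⊢C refl))
    go Δ (appl {N = N′} {B = B} ⊢M ⊢N′) refl =
      cast refl (sym (subst-[] (exts⋆ Δ (single N)) B N′)) (appl (go Δ ⊢M refl) (go Δ ⊢N′ refl))
    go Δ (abst {A = A′} ⊢M i ⊢Π) refl = abst (go (Δ ▸ A′) ⊢M refl) i (go Δ ⊢Π refl)
    go Δ (prod {A = A′} ⊢B ⊢A r) refl = prod (go (Δ ▸ A′) ⊢B refl) (go Δ ⊢A refl) r
    go Δ (conv ⊢M i ⊢B A=B) refl =
      conv (go Δ ⊢M refl) i (go Δ ⊢B refl) (subst-=β (exts⋆ Δ (single N)) A=B)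

  pi-generation : Γ ⊢ pi A B ∶ C → Γ ▸ A ⊢ B type
  pi-generation ⊢Π = go ⊢Π refl
    where
    go : ∀ {Γ X C A B} → Γ ⊢ X ∶ C → X ≡ pi A B → Γ ▸ A ⊢ B type
    go (axiom _)   ()
    go (start _ _) ()
    go (weak {M = var _}   _ _ _) ()
    go (weak {M = const _} _ _ _) ()
    go (weak {M = lam _ _} _ _ _) ()
    go (weak {M = app _ _} _ _ _) ()
    go (weak {Γ = Γ} {M = pi A _} ⊢Π i ⊢C) refl =
      let s , j , ⊢B = go ⊢Π refl in s , j , thinning Γ (ε ▸ A) ⊢B (_ , i , ⊢C)
    go (appl _ _)     ()
    go (abst _ _ _)   ()
    go (prod ⊢B _ r)  refl = _ , rule-sort₂ r , ⊢B
    go (conv ⊢X _ _ _) eq  = go ⊢X eq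

  NoTopSorts : Set
  NoTopSorts = ∀ {s} → IsSort s → Σ Const λ s′ → IsSort s′ × Axiom s s′

  supersorted⇒noTopSorts : Supersorted P → NoTopSorts
  supersorted⇒noTopSorts SS {s} _ = Supersorted.const-typed SS s

  type-correctness : NoTopSorts → Γ ⊢ M ∶ B → Γ ⊢ B type
  type-correctness typed (axiom ax) =
    let s′ , i , ax′ = typed (axiom-sort ax) in s′ , i , axiom ax′
  type-correctness typed (start i ⊢A) = _ , i , weak ⊢A i ⊢A
  type-correctness typed (weak ⊢M i ⊢A) =
    let s , j , ⊢B = type-correctness typed ⊢M in s , j , weak ⊢B i ⊢A
  type-correctness {Γ} typed (appl ⊢M ⊢N) =
    let _ , _ , ⊢Π = type-correctness typed ⊢M
        s , i , ⊢B = pi-generation ⊢Π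
    in s , i , substitution Γ ε ⊢B ⊢N
  type-correctness typed (abst _ i ⊢Π) = _ , i , ⊢Π
  type-correctness {Γ} typed (prod _ ⊢A r) =
    let s′ , i , ax = typed (rule-sort₃ r) in s′ , i , axiom-in-context Γ ⊢A ax
  type-correctness typed (conv _ i ⊢B _) = _ , i , ⊢B

  abstraction-admissible : Supersorted P → Γ ▸ A ⊢ M ∶ B → Γ ⊢ lam A M ∶ pi A B
  abstraction-admissible SS ⊢M =
    let s₁ , i₁ , ⊢A = context-head-type ⊢M
        s₂ , i₂ , ⊢B = type-correctness (supersorted⇒noTopSorts SS) ⊢M
        s₃ , i₃ , r  = Supersorted.rule-total SS s₁ s₂ i₁ i₂
    in abst ⊢M i₃ (prod ⊢B ⊢A r)

  ⊢⇒⊢′ : Γ ⊢ M ∶ B → Γ ⊢′ M ∶ B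
  ⊢⇒⊢′ (axiom ax)        = axiom ax
  ⊢⇒⊢′ (start i ⊢A)      = start i (⊢⇒⊢′ ⊢A)
  ⊢⇒⊢′ (weak ⊢M i ⊢A)    = weak (⊢⇒⊢′ ⊢M) i (⊢⇒⊢′ ⊢A)
  ⊢⇒⊢′ (appl ⊢M ⊢N)      = appl (⊢⇒⊢′ ⊢M) (⊢⇒⊢′ ⊢N)
  ⊢⇒⊢′ (abst ⊢M _ _)     = abst′ (⊢⇒⊢′ ⊢M)
  ⊢⇒⊢′ (prod ⊢B ⊢A r)    = prod (⊢⇒⊢′ ⊢B) (⊢⇒⊢′ ⊢A) r
  ⊢⇒⊢′ (conv ⊢M i ⊢B eq) = conv (⊢⇒⊢′ ⊢M) i (⊢⇒⊢′ ⊢B) eq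

  ⊢′⇒⊢ : Supersorted P → Γ ⊢′ M ∶ B → Γ ⊢ M ∶ B
  ⊢′⇒⊢ SS (axiom ax)        = axiom ax
  ⊢′⇒⊢ SS (start i ⊢A)      = start i (⊢′⇒⊢ SS ⊢A)
  ⊢′⇒⊢ SS (weak ⊢M i ⊢A)    = weak (⊢′⇒⊢ SS ⊢M) i (⊢′⇒⊢ SS ⊢A)
  ⊢′⇒⊢ SS (appl ⊢M ⊢N)      = appl (⊢′⇒⊢ SS ⊢M) (⊢′⇒⊢ SS ⊢N)
  ⊢′⇒⊢ SS (abst′ ⊢M)        = abstraction-admissible SS (⊢′⇒⊢ SS ⊢M)
  ⊢′⇒⊢ SS (prod ⊢B ⊢A r)    = prod (⊢′⇒⊢ SS ⊢B) (⊢′⇒⊢ SS ⊢A) r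
  ⊢′⇒⊢ SS (conv ⊢M i ⊢B eq) = conv (⊢′⇒⊢ SS ⊢M) i (⊢′⇒⊢ SS ⊢B) eq

open Defs using (_⊢_∶_; _⊢′_∶_)

theorem16 : (P : PTS) → Supersorted P →
    ((Γ : Ctx P) (A M B : Term P) →
       _⊢_∶_ P (_▸_ Γ A) M B → _⊢_∶_ P Γ (lam A M) (pi A B))
    × ((Γ : Ctx P) (M B : Term P) →
       (_⊢_∶_ P Γ M B → _⊢′_∶_ P Γ M B) × (_⊢′_∶_ P Γ M B → _⊢_∶_ P Γ M B))
theorem16 P SS =
  (λ _ _ _ _ → abstraction-admissible SS) , (λ _ _ _ → ⊢⇒⊢′ , ⊢′⇒⊢ SS)
  where open Metatheory P
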